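{- Let $\lambda\in\mathbb{C}$ with $\lambda\neq 1$, let $r,k\in\mathbb{Z}$ and $n\geq 1$. Then \[ T_{n}^{(r,k)}(x|\lambda)=(x-r)T_{n-1}^{(r,k)}(x|\lambda)-\frac{r\lambda }{1-\lambda}T_{n-1}^{(r+1,k)}(x|\lambda) +\sum_{l=0}^{n-1}\left\{(-1)^{n-1-l}\binom{n-1}{l}\sum_{m=0}^{n-1-l}(-1)^{m}\frac{(m+1)!}{(m+2)^{k}}S_{2}(n-1-l,m)\right\}H_{l}^{(r)}(x-1|\lambda). \]
   Context: For $k\in\mathbb{Z}$, $Li_k(x)=\sum_{n\ge1}x^n/n^k$. For $r,k\in\mathbb{Z}$ the polynomials $T_n^{(r,k)}(x|\lambda)$ are defined by $\left(\frac{1-\lambda}{e^t-\lambda}\right)^r\frac{Li_{k}(1-e^{ -t})}{1-e^{ -t}}e^{xt}=\sum_{n\ge0}T_n^{(r,k)}(x|\lambda)\frac{t^n}{n!}$ (as formal power series in $t$). The Frobenius-Euler polynomials of order $r$ are defined by $\left(\frac{1-\lambda}{e^t-\lambda}\right)^{r}e^{xt}=\sum_{n\ge0}H_n^{(r)}(x|\lambda)\frac{t^n}{n!}$. $S_2(l,m)$ denotes the Stirling numbers of the second kind, $(e^t-1)^m=m!\sum_{l\ge m}S_2(l,m)\frac{t^l}{l!}$. -}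

module Defs where

open import Level using (_⊔_)
open import Algebra.Bundles using (CommutativeRing)
open import Data.Nat using (ℕ; zero; suc; _∸_; _!)
open import Data.Integer using (ℤ; +_; -[1+_])
open import Data.Vec using (Vec; []; _∷_; lookup; head)
open import Data.Fin using (Fin; toℕ)
open import Relation.Nullary using (¬_)

ιℕ : ∀ {c ℓ} (R : CommutativeRing c ℓ) → ℕ → CommutativeRing.Carrier R
ιℕ R zero    = CommutativeRing.0# R
ιℕ R (suc n) = CommutativeRing._+_ R (CommutativeRing.1# R) (ιℕ R n)

-- A field of characteristic zero (stand-in for ℂ, which agda-stdlib lacks).
-- The inverse is a total function; its value at 0 is irrelevant.
record CharZeroField c ℓ : Set (Level.suc (c ⊔ ℓ)) where
  field
    commutativeRing : CommutativeRing c ℓ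
  open CommutativeRing commutativeRing public
  field
    _⁻¹      : Carrier → Carrier
    inverseʳ : ∀ x → ¬ (x ≈ 0#) → (x * (x ⁻¹)) ≈ 1#
    charZero : ∀ n → ¬ (ιℕ commutativeRing (suc n) ≈ 0#)

S₂ : ℕ → ℕ → ℕ
S₂ zero    zero    = 1
S₂ zero    (suc m) = 0
S₂ (suc n) zero    = 0
S₂ (suc n) (suc m) = suc m Data.Nat.* S₂ n (suc m) Data.Nat.+ S₂ n m

module FPS {c ℓ} (F : CharZeroField c ℓ) where
  open CharZeroField F

  ι : ℕ → Carrier
  ι = ιℕ commutativeRing

  ιℤ : ℤ → Carrier
  ιℤ (+ n)     = ι n
  ιℤ -[1+ n ]  = - ι (suc n)

  _^ᶠ_ : Carrier → ℕ → Carrier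
  x ^ᶠ zero  = 1#
  x ^ᶠ suc n = x * (x ^ᶠ n)

  _^ℤ_ : Carrier → ℤ → Carrier
  x ^ℤ (+ n)    = x ^ᶠ n
  x ^ℤ -[1+ n ] = (x ^ᶠ suc n) ⁻¹

  sumTo : ℕ → (ℕ → Carrier) → Carrier
  sumTo zero    f = 0#
  sumTo (suc n) f = sumTo n f + f n

  -- formal power series in t, given by their ordinary coefficients
  Series : Set c
  Series = ℕ → Carrier

  const : Carrier → Series
  const a zero    = a
  const a (suc n) = 0#

  one : Series
  one = const 1#

  _⊕_ : Series → Series → Series
  (a ⊕ b) n = a n + b n

  ⊖_ : Series → Series
  (⊖ a) n = - a n

  _⊛_ : Series → Series → Series
  (a ⊛ b) n = sumTo (suc n) (λ i → a i * b (n ∸ i))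

  pow : Series → ℕ → Series
  pow a zero    = one
  pow a (suc m) = a ⊛ pow a m

  -- multiplicative inverse of a series with invertible constant term:
  -- b₀ = a₀⁻¹,  b_{n+1} = - a₀⁻¹ Σ_{i=1}^{n+1} a_i b_{n+1-i}.
  -- invVec a n = b_n ∷ b_{n-1} ∷ … ∷ b_0
  -- j-th entry of a vector (0 if out of range)
  at : ∀ {m} → ℕ → Vec Carrier m → Carrier
  at _       []       = 0#
  at zero    (x ∷ xs) = x
  at (suc j) (x ∷ xs) = at j xs

  invVec : Series → (n : ℕ) → Vec Carrier (suc n)
  invVec a zero    = (a 0 ⁻¹) ∷ []
  invVec a (suc n) =
    (- ((a 0 ⁻¹) * sumTo (suc n) (λ j → a (suc j) * at j v))) ∷ v
    where
      v = invVec a n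

  inv : Series → Series
  inv a n = head (invVec a n)

  powℤ : Series → ℤ → Series
  powℤ a (+ m)    = pow a m
  powℤ a -[1+ m ] = pow (inv a) (suc m)

  -- composition f(g(t)) for g with zero constant term
  compose : Series → Series → Series
  compose f g n = sumTo (suc n) (λ m → f m * pow g m n)

  expS : Carrier → Series
  expS a n = (a ^ᶠ n) * (ι (n !) ⁻¹)

  LiOverId : ℤ → Series
  LiOverId k m = (ι (suc m) ^ℤ k) ⁻¹

  frobKernel : Carrier → Series
  frobKernel lam = const (1# - lam) ⊛ inv (expS 1# ⊕ (⊖ const lam))

  oneMinusExpNeg : Series
  oneMinusExpNeg = one ⊕ (⊖ expS (- 1#))

  T : Carrier → ℤ → ℤ → ℕ → Carrier → Carrier
  T lam r k n x =
    ι (n !) * (((powℤ (frobKernel lam) r ⊛ compose (LiOverId k) oneMinusExpNeg) ⊛ expS x) n)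

  H : Carrier → ℤ → ℕ → Carrier → Carrier
  H lam r n x = ι (n !) * ((powℤ (frobKernel lam) r ⊛ expS x) n)

-- Let K = (1-λ)/(e^t-λ), y = 1 - e^{-t}, C = Li_k(y)/y as a series in t, and
-- G = K^r C e^{xt}, so that T_n = n! [t^n] G and T_{n+1} = n! [t^n] G′.
-- From K′ = -K - λ/(1-λ) K² one gets (K^r)′ = -r K^r - rλ/(1-λ) K^{r+1}, which
-- produces the first two terms. Since y′ = e^{-t}, the chain rule gives
-- C′ = W e^{-t} with W = Σ_m (m+1) c_{m+1} y^m, where c_m = (m+1)^{-k} and
-- [t^l] y^m = (-1)^{l+m} m! S₂(l,m)/l!; finally e^{-t} e^{xt} = e^{(x-1)t}, so
-- K^r e^{(x-1)t} generates H_l^{(r)}(x-1) and the Cauchy product with W gives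
-- the binomial sum. Identities between series (e^{at}e^{bt} = e^{(a+b)t}, the
-- closed form of y^m) are proved by checking that both sides solve the same
-- recurrence f_{n+1} = Φ(f_n)/(n+1), which is possible in characteristic zero.
{-# OPTIONS --safe #-}
module Submission where

open import Defs
open import Data.Nat as ℕ using (ℕ; zero; suc; _∸_; _!; z≤n; s≤s)
  renaming (_+_ to _+ℕ_; _*_ to _*ℕ_; _<_ to _<ℕ_; _≤_ to _≤ℕ_)
import Data.Nat.Properties as ℕ
open import Data.Nat.Combinatorics using (_C_; k![n∸k]!∣n!)
open import Data.Nat.Combinatorics.Specification using (nCk≡n!/k![n-k]!)
open import Data.Nat.DivMod using (m/n*n≡m)
open import Data.Integer using (ℤ; +_; -[1+_]) renaming (_+_ to _+ℤ_)
open import Relation.Nullary using (¬_)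
open import Relation.Binary.PropositionalEquality as ≡ using (_≡_)
import Algebra.Properties.Ring as RingProperties
import Algebra.Properties.Group as GroupProperties
import Algebra.Solver.Ring.NaturalCoefficients.Default as NaturalCoefficients

S₂-< : ∀ l m → l <ℕ m → S₂ l m ≡ 0
S₂-< zero    (suc m) _         = ≡.refl
S₂-< (suc l) (suc m) (s≤s l<m)
  rewrite S₂-< l (suc m) (ℕ.m<n⇒m<1+n l<m) | S₂-< l m l<m | ℕ.*-zeroʳ m = ≡.refl

n!≡[nCl]*[l!*[n∸l]!] : ∀ n l → l ≤ℕ n → n ! ≡ (n C l) *ℕ (l ! *ℕ (n ∸ l) !)
n!≡[nCl]*[l!*[n∸l]!] n l l≤n =
  ≡.trans (≡.sym (m/n*n≡m (k![n∸k]!∣n! l≤n)))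
          (≡.cong (_*ℕ (l ! *ℕ (n ∸ l) !)) (≡.sym (nCk≡n!/k![n-k]! l≤n)))
  where instance _ = l ℕ.!* (n ∸ l) !≢0

module FieldLemmas {c ℓ} (F : CharZeroField c ℓ) where
  open CharZeroField F
  open FPS F
  open import Relation.Binary.Reasoning.Setoid setoid public
  open RingProperties ring using (-‿distribˡ-*; -‿distribʳ-*; -0#≈0#; -1*x≈-x) public
  open GroupProperties +-group public
    using () renaming (⁻¹-involutive to -‿involutive; inverseʳ-unique to -‿unique; ⁻¹-anti-homo-∙ to -‿anti-homo-+)
  open NaturalCoefficients commutativeSemiring using (solve; _:=_; _:+_; _:*_) public

  -‿distrib-+ : ∀ a b → - (a + b) ≈ - a + - b
  -‿distrib-+ a b = trans (-‿anti-homo-+ a b) (+-comm (- b) (- a))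

  ι-+ : ∀ m n → ι (m +ℕ n) ≈ ι m + ι n
  ι-+ zero    n = sym (+-identityˡ _)
  ι-+ (suc m) n = trans (+-congˡ (ι-+ m n)) (sym (+-assoc _ _ _))

  ι-* : ∀ m n → ι (m *ℕ n) ≈ ι m * ι n
  ι-* zero    n = sym (zeroˡ _)
  ι-* (suc m) n = begin
    ι (n +ℕ m *ℕ n)         ≈⟨ ι-+ n (m *ℕ n) ⟩
    ι n + ι (m *ℕ n)        ≈⟨ +-cong (sym (*-identityˡ _)) (ι-* m n) ⟩
    1# * ι n + ι m * ι n    ≈⟨ sym (distribʳ _ _ _) ⟩
    (1# + ι m) * ι n        ∎

  ι-1 : ι 1 ≈ 1#
  ι-1 = +-identityʳ _

  1≉0 : ¬ (1# ≈ 0#)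
  1≉0 e = charZero 0 (trans ι-1 e)

  inverseˡ : ∀ x → ¬ (x ≈ 0#) → (x ⁻¹) * x ≈ 1#
  inverseˡ x x≉0 = trans (*-comm _ _) (inverseʳ x x≉0)

  *-cancelˡ : ∀ {a x y} → ¬ (a ≈ 0#) → a * x ≈ a * y → x ≈ y
  *-cancelˡ {a} {x} {y} a≉0 e = begin
    x                ≈⟨ sym (*-identityˡ x) ⟩
    1# * x           ≈⟨ *-congʳ (sym (inverseˡ a a≉0)) ⟩
    (a ⁻¹ * a) * x   ≈⟨ *-assoc _ _ _ ⟩
    a ⁻¹ * (a * x)   ≈⟨ *-congˡ e ⟩
    a ⁻¹ * (a * y)   ≈⟨ sym (*-assoc _ _ _) ⟩
    (a ⁻¹ * a) * y   ≈⟨ *-congʳ (inverseˡ a a≉0) ⟩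
    1# * y           ≈⟨ *-identityˡ y ⟩
    y                ∎

  *-≉0 : ∀ {a b} → ¬ (a ≈ 0#) → ¬ (b ≈ 0#) → ¬ (a * b ≈ 0#)
  *-≉0 {a} {b} a≉0 b≉0 ab≈0 = b≉0 (*-cancelˡ a≉0 (trans ab≈0 (sym (zeroʳ a))))

  ⁻¹-unique : ∀ {a b} → ¬ (a ≈ 0#) → a * b ≈ 1# → b ≈ a ⁻¹
  ⁻¹-unique {a} a≉0 e = *-cancelˡ a≉0 (trans e (sym (inverseʳ a a≉0)))

  ⁻¹-cong : ∀ {a b} → ¬ (a ≈ 0#) → a ≈ b → a ⁻¹ ≈ b ⁻¹
  ⁻¹-cong {a} a≉0 a≈b =
    ⁻¹-unique (λ b≈0 → a≉0 (trans a≈b b≈0)) (trans (*-congʳ (sym a≈b)) (inverseʳ a a≉0))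

  ⁻¹-distrib-* : ∀ {a b} → ¬ (a ≈ 0#) → ¬ (b ≈ 0#) → (a * b) ⁻¹ ≈ a ⁻¹ * b ⁻¹
  ⁻¹-distrib-* {a} {b} a≉0 b≉0 = sym (⁻¹-unique (*-≉0 a≉0 b≉0) (begin
    (a * b) * (a ⁻¹ * b ⁻¹)   ≈⟨ solve 4 (λ a b a′ b′ → (a :* b) :* (a′ :* b′) := (a :* a′) :* (b :* b′)) refl a b (a ⁻¹) (b ⁻¹) ⟩
    (a * a ⁻¹) * (b * b ⁻¹)   ≈⟨ *-cong (inverseʳ a a≉0) (inverseʳ b b≉0) ⟩
    1# * 1#                   ≈⟨ *-identityˡ _ ⟩
    1#                        ∎))

  ι[1]⁻¹≈1 : ι 1 ⁻¹ ≈ 1#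
  ι[1]⁻¹≈1 = sym (⁻¹-unique (charZero 0) (trans (*-identityʳ _) ι-1))

  ι[n!]≉0 : ∀ n → ¬ (ι (n !) ≈ 0#)
  ι[n!]≉0 zero    = charZero 0
  ι[n!]≉0 (suc n) e = *-≉0 (charZero n) (ι[n!]≉0 n) (trans (sym (ι-* (suc n) (n !))) e)

  ι[1+n]*ι[[1+n]!]⁻¹≈ι[n!]⁻¹ : ∀ n → ι (suc n) * (ι (suc n !) ⁻¹) ≈ ι (n !) ⁻¹
  ι[1+n]*ι[[1+n]!]⁻¹≈ι[n!]⁻¹ n = begin
    ι (suc n) * (ι (suc n !) ⁻¹)              ≈⟨ *-congˡ (⁻¹-cong (ι[n!]≉0 (suc n)) (ι-* (suc n) (n !))) ⟩
    ι (suc n) * ((ι (suc n) * ι (n !)) ⁻¹)    ≈⟨ *-congˡ (⁻¹-distrib-* (charZero n) (ι[n!]≉0 n)) ⟩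
    ι (suc n) * (ι (suc n) ⁻¹ * ι (n !) ⁻¹)   ≈⟨ sym (*-assoc _ _ _) ⟩
    (ι (suc n) * ι (suc n) ⁻¹) * ι (n !) ⁻¹   ≈⟨ *-congʳ (inverseʳ _ (charZero n)) ⟩
    1# * ι (n !) ⁻¹                           ≈⟨ *-identityˡ _ ⟩
    ι (n !) ⁻¹                                ∎

  sign : ℕ → Carrier
  sign j = (- 1#) ^ᶠ j

  sign-suc : ∀ j → sign (suc j) ≈ - sign j
  sign-suc j = -1*x≈-x _

  sign-2+ : ∀ j → sign (suc (suc j)) ≈ sign j
  sign-2+ j = trans (sign-suc (suc j)) (trans (-‿cong (sign-suc j)) (-‿involutive _))

  sign-+ : ∀ i j → sign (i +ℕ j) ≈ sign i * sign j
  sign-+ zero    j = sym (*-identityˡ _)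
  sign-+ (suc i) j = trans (*-congˡ (sign-+ i j)) (sym (*-assoc _ _ _))

module SumLemmas {c ℓ} (F : CharZeroField c ℓ) where
  open CharZeroField F
  open FPS F
  open FieldLemmas F

  sumTo-cong-< : ∀ n {f g} → (∀ i → i <ℕ n → f i ≈ g i) → sumTo n f ≈ sumTo n g
  sumTo-cong-< zero    f≈g = refl
  sumTo-cong-< (suc n) f≈g =
    +-cong (sumTo-cong-< n (λ i i<n → f≈g i (ℕ.m<n⇒m<1+n i<n))) (f≈g n ℕ.≤-refl)

  sumTo-cong : ∀ n {f g} → (∀ i → f i ≈ g i) → sumTo n f ≈ sumTo n g
  sumTo-cong n f≈g = sumTo-cong-< n (λ i _ → f≈g i)

  sumTo-zero : ∀ n {f} → (∀ i → i <ℕ n → f i ≈ 0#) → sumTo n f ≈ 0#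
  sumTo-zero zero    f≈0 = refl
  sumTo-zero (suc n) f≈0 =
    trans (+-cong (sumTo-zero n (λ i i<n → f≈0 i (ℕ.m<n⇒m<1+n i<n))) (f≈0 n ℕ.≤-refl)) (+-identityˡ _)

  sumTo-+ : ∀ n f g → sumTo n (λ i → f i + g i) ≈ sumTo n f + sumTo n g
  sumTo-+ zero    f g = sym (+-identityˡ _)
  sumTo-+ (suc n) f g = trans (+-congʳ (sumTo-+ n f g))
    (solve 4 (λ a b x y → (a :+ b) :+ (x :+ y) := (a :+ x) :+ (b :+ y)) refl _ _ _ _)

  sumTo-*ˡ : ∀ n a f → a * sumTo n f ≈ sumTo n (λ i → a * f i)
  sumTo-*ˡ zero    a f = zeroʳ a
  sumTo-*ˡ (suc n) a f = trans (distribˡ _ _ _) (+-congʳ (sumTo-*ˡ n a f))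

  sumTo-*ʳ : ∀ n a f → sumTo n f * a ≈ sumTo n (λ i → f i * a)
  sumTo-*ʳ n a f = trans (*-comm _ _) (trans (sumTo-*ˡ n a f) (sumTo-cong n (λ i → *-comm _ _)))

  -‿sumTo : ∀ n f → - sumTo n f ≈ sumTo n (λ i → - f i)
  -‿sumTo zero    f = -0#≈0#
  -‿sumTo (suc n) f = trans (-‿distrib-+ _ _) (+-congʳ (-‿sumTo n f))

  sumTo-first : ∀ n f → sumTo (suc n) f ≈ f 0 + sumTo n (λ i → f (suc i))
  sumTo-first zero    f = trans (+-identityˡ _) (sym (+-identityʳ _))
  sumTo-first (suc n) f = trans (+-congʳ (sumTo-first n f)) (+-assoc _ _ _)

  sumTo-reverse : ∀ n f → sumTo n f ≈ sumTo n (λ i → f (n ∸ suc i))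
  sumTo-reverse zero    f = refl
  sumTo-reverse (suc n) f = begin
    sumTo n f + f n                           ≈⟨ +-comm _ _ ⟩
    f n + sumTo n f                           ≈⟨ +-congˡ (sumTo-reverse n f) ⟩
    f n + sumTo n (λ i → f (n ∸ suc i))       ≈⟨ sym (sumTo-first n (λ i → f (n ∸ i))) ⟩
    sumTo (suc n) (λ i → f (n ∸ i))           ∎

  sumTo-swap : ∀ n m (f : ℕ → ℕ → Carrier) →
               sumTo n (λ i → sumTo m (f i)) ≈ sumTo m (λ j → sumTo n (λ i → f i j))
  sumTo-swap zero    m f = sym (sumTo-zero m (λ _ _ → refl))
  sumTo-swap (suc n) m f = trans (+-congʳ (sumTo-swap n m f)) (sym (sumTo-+ m _ _))

  sumTo-vanishing-tail : ∀ m d {f} → (∀ i → m ≤ℕ i → i <ℕ m +ℕ d → f i ≈ 0#) →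
                         sumTo (m +ℕ d) f ≈ sumTo m f
  sumTo-vanishing-tail m zero    {f} _   = reflexive (≡.cong (λ k → sumTo k f) (ℕ.+-identityʳ m))
  sumTo-vanishing-tail m (suc d) {f} f≈0 = begin
    sumTo (m +ℕ suc d) f              ≈⟨ reflexive (≡.cong (λ k → sumTo k f) (ℕ.+-suc m d)) ⟩
    sumTo (m +ℕ d) f + f (m +ℕ d)     ≈⟨ +-cong (sumTo-vanishing-tail m d tail≈0) last≈0 ⟩
    sumTo m f + 0#                    ≈⟨ +-identityʳ _ ⟩
    sumTo m f                         ∎
    where
      tail≈0 : ∀ i → m ≤ℕ i → i <ℕ m +ℕ d → f i ≈ 0#
      tail≈0 i m≤i i<m+d = f≈0 i m≤i (ℕ.<-≤-trans i<m+d (ℕ.+-monoʳ-≤ m (ℕ.n≤1+n d)))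
      last≈0 : f (m +ℕ d) ≈ 0#
      last≈0 = f≈0 (m +ℕ d) (ℕ.m≤m+n m d) (ℕ.≤-reflexive (≡.sym (ℕ.+-suc m d)))

  sumTo-triangle : ∀ n (G : ℕ → ℕ → Carrier) →
                   sumTo (suc n) (λ i → sumTo (suc i) (λ j → G j (i ∸ j)))
                   ≈ sumTo (suc n) (λ j → sumTo (suc (n ∸ j)) (G j))
  sumTo-triangle zero    G = refl
  sumTo-triangle (suc n) G = begin
    sumTo (suc n) (λ i → sumTo (suc i) (λ j → G j (i ∸ j))) + sumTo (suc (suc n)) (λ j → G j (suc n ∸ j))
      ≈⟨ +-congʳ (sumTo-triangle n G) ⟩
    R + (sumTo (suc n) (λ j → G j (suc n ∸ j)) + G (suc n) (n ∸ n))
      ≈⟨ +-congˡ (+-cong (sumTo-cong-< (suc n) (λ j j<1+n → reflexive (≡.cong (G j) (ℕ.+-∸-assoc 1 (ℕ.≤-pred j<1+n)))))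
                         (reflexive (≡.cong (G (suc n)) (ℕ.n∸n≡0 n)))) ⟩
    R + (sumTo (suc n) (λ j → G j (suc (n ∸ j))) + G (suc n) 0)
      ≈⟨ sym (+-assoc _ _ _) ⟩
    (R + sumTo (suc n) (λ j → G j (suc (n ∸ j)))) + G (suc n) 0
      ≈⟨ +-congʳ (sym (sumTo-+ (suc n) _ _)) ⟩
    sumTo (suc n) (λ j → sumTo (suc (n ∸ j)) (G j) + G j (suc (n ∸ j))) + G (suc n) 0
      ≈⟨ +-cong (sumTo-cong-< (suc n) (λ j j<1+n → sym (extend (G j) (ℕ.≤-pred j<1+n))))
                (trans (sym (+-identityˡ _)) (reflexive (≡.cong (λ m → sumTo (suc m) (G (suc n))) (≡.sym (ℕ.n∸n≡0 n))))) ⟩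
    sumTo (suc n) (λ j → sumTo (suc (suc n ∸ j)) (G j)) + sumTo (suc (n ∸ n)) (G (suc n)) ∎
    where
      R : Carrier
      R = sumTo (suc n) (λ j → sumTo (suc (n ∸ j)) (G j))
      extend : ∀ {j} (g : ℕ → Carrier) → j ≤ℕ n → sumTo (suc (suc n ∸ j)) g ≈ sumTo (suc (n ∸ j)) g + g (suc (n ∸ j))
      extend g j≤n rewrite ℕ.+-∸-assoc 1 j≤n = refl

module SeriesRing {c ℓ} (F : CharZeroField c ℓ) where
  open CharZeroField F
  open FPS F
  open FieldLemmas F
  open SumLemmas F

  infix 4 _≋_
  _≋_ : Series → Series → Set ℓ
  a ≋ b = ∀ n → a n ≈ b n

  ≋-refl : ∀ {a} → a ≋ a
  ≋-refl n = refl

  ≋-sym : ∀ {a b} → a ≋ b → b ≋ a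
  ≋-sym a≋b n = sym (a≋b n)

  ≋-trans : ∀ {a b d} → a ≋ b → b ≋ d → a ≋ d
  ≋-trans a≋b b≋d n = trans (a≋b n) (b≋d n)

  zeroS : Series
  zeroS n = 0#

  sc : Carrier → Series → Series
  sc a s n = a * s n

  ⊕-cong : ∀ {a a′ b b′} → a ≋ a′ → b ≋ b′ → a ⊕ b ≋ a′ ⊕ b′
  ⊕-cong a≋a′ b≋b′ n = +-cong (a≋a′ n) (b≋b′ n)

  ⊖-cong : ∀ {a a′} → a ≋ a′ → ⊖ a ≋ ⊖ a′
  ⊖-cong a≋a′ n = -‿cong (a≋a′ n)

  ⊛-cong : ∀ {a a′ b b′} → a ≋ a′ → b ≋ b′ → a ⊛ b ≋ a′ ⊛ b′
  ⊛-cong a≋a′ b≋b′ n = sumTo-cong (suc n) (λ i → *-cong (a≋a′ i) (b≋b′ (n ∸ i)))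

  ⊛-congˡ : ∀ a {b b′} → b ≋ b′ → a ⊛ b ≋ a ⊛ b′
  ⊛-congˡ a = ⊛-cong (≋-refl {a})

  ⊛-congʳ : ∀ b {a a′} → a ≋ a′ → a ⊛ b ≋ a′ ⊛ b
  ⊛-congʳ b a≋a′ = ⊛-cong a≋a′ (≋-refl {b})

  ⊛-0 : ∀ a b → (a ⊛ b) 0 ≈ a 0 * b 0
  ⊛-0 a b = +-identityˡ _

  ⊛-comm : ∀ a b → a ⊛ b ≋ b ⊛ a
  ⊛-comm a b n = begin
    sumTo (suc n) (λ i → a i * b (n ∸ i))                 ≈⟨ sumTo-reverse (suc n) _ ⟩
    sumTo (suc n) (λ i → a (n ∸ i) * b (n ∸ (n ∸ i)))     ≈⟨ sumTo-cong-< (suc n) swap ⟩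
    sumTo (suc n) (λ i → b i * a (n ∸ i))                 ∎
    where
      swap : ∀ i → i <ℕ suc n → a (n ∸ i) * b (n ∸ (n ∸ i)) ≈ b i * a (n ∸ i)
      swap i i<1+n = trans (*-comm _ _) (*-congʳ (reflexive (≡.cong b (ℕ.m∸[m∸n]≡n (ℕ.≤-pred i<1+n)))))

  ⊛-assoc : ∀ a b d → (a ⊛ b) ⊛ d ≋ a ⊛ (b ⊛ d)
  ⊛-assoc a b d n = begin
    sumTo (suc n) (λ i → sumTo (suc i) (λ j → a j * b (i ∸ j)) * d (n ∸ i))
      ≈⟨ sumTo-cong-< (suc n) (λ i _ → trans (sumTo-*ʳ (suc i) _ _) (sumTo-cong-< (suc i) (λ j j<1+i →
           *-congˡ (reflexive (≡.cong (λ m → d (n ∸ m)) (≡.sym (ℕ.m+[n∸m]≡n (ℕ.≤-pred j<1+i)))))))) ⟩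
    sumTo (suc n) (λ i → sumTo (suc i) (λ j → G j (i ∸ j)))
      ≈⟨ sumTo-triangle n G ⟩
    sumTo (suc n) (λ j → sumTo (suc (n ∸ j)) (G j))
      ≈⟨ sumTo-cong (suc n) (λ j → trans (sumTo-cong (suc (n ∸ j)) (λ k → trans (*-assoc _ _ _)
           (*-congˡ (*-congˡ (reflexive (≡.cong d (≡.sym (ℕ.∸-+-assoc n j k)))))))) (sym (sumTo-*ˡ (suc (n ∸ j)) (a j) _))) ⟩
    sumTo (suc n) (λ j → a j * sumTo (suc (n ∸ j)) (λ k → b k * d (n ∸ j ∸ k))) ∎
    where
      G : ℕ → ℕ → Carrier
      G j k = (a j * b k) * d (n ∸ (j +ℕ k))

  ⊛-distribˡ : ∀ a b d → d ⊛ (a ⊕ b) ≋ (d ⊛ a) ⊕ (d ⊛ b)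
  ⊛-distribˡ a b d n = trans (sumTo-cong (suc n) (λ i → distribˡ _ _ _)) (sumTo-+ (suc n) _ _)

  ⊛-distribʳ : ∀ a b d → (a ⊕ b) ⊛ d ≋ (a ⊛ d) ⊕ (b ⊛ d)
  ⊛-distribʳ a b d n = trans (sumTo-cong (suc n) (λ i → distribʳ _ _ _)) (sumTo-+ (suc n) _ _)

  ⊖-⊛ : ∀ a b → (⊖ a) ⊛ b ≋ ⊖ (a ⊛ b)
  ⊖-⊛ a b n = trans (sumTo-cong (suc n) (λ i → sym (-‿distribˡ-* _ _))) (sym (-‿sumTo (suc n) _))

  ⊛-⊖ : ∀ a b → a ⊛ (⊖ b) ≋ ⊖ (a ⊛ b)
  ⊛-⊖ a b n = trans (sumTo-cong (suc n) (λ i → sym (-‿distribʳ-* _ _))) (sym (-‿sumTo (suc n) _))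

  ⊛-zeroʳ : ∀ a → a ⊛ zeroS ≋ zeroS
  ⊛-zeroʳ a n = sumTo-zero (suc n) (λ _ _ → zeroʳ _)

  const-⊛ : ∀ x b → const x ⊛ b ≋ sc x b
  const-⊛ x b n = begin
    sumTo (suc n) (λ i → const x i * b (n ∸ i))        ≈⟨ sumTo-first n _ ⟩
    x * b n + sumTo n (λ i → 0# * b (n ∸ suc i))       ≈⟨ +-congˡ (sumTo-zero n (λ i _ → zeroˡ _)) ⟩
    x * b n + 0#                                       ≈⟨ +-identityʳ _ ⟩
    x * b n                                            ∎

  ⊛-identityˡ : ∀ b → one ⊛ b ≋ b
  ⊛-identityˡ b n = trans (const-⊛ 1# b n) (*-identityˡ _)

  ⊛-identityʳ : ∀ b → b ⊛ one ≋ b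
  ⊛-identityʳ b = ≋-trans (⊛-comm b one) (⊛-identityˡ b)

  sc-⊛ : ∀ x a b → sc x a ⊛ b ≋ sc x (a ⊛ b)
  sc-⊛ x a b n = trans (sumTo-cong (suc n) (λ i → *-assoc _ _ _)) (sym (sumTo-*ˡ (suc n) x _))

  ⊛-sc : ∀ x a b → a ⊛ sc x b ≋ sc x (a ⊛ b)
  ⊛-sc x a b = ≋-trans (⊛-comm a (sc x b)) (≋-trans (sc-⊛ x b a) (λ n → *-congˡ (⊛-comm b a n)))

module Derivative {c ℓ} (F : CharZeroField c ℓ) where
  open CharZeroField F
  open FPS F
  open FieldLemmas F
  open SumLemmas F
  open SeriesRing F

  ∂ : Series → Series
  ∂ a n = ι (suc n) * a (suc n)

  ∂-cong : ∀ {a b} → a ≋ b → ∂ a ≋ ∂ b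
  ∂-cong a≋b n = *-congˡ (a≋b (suc n))

  ∂-⊕ : ∀ a b → ∂ (a ⊕ b) ≋ ∂ a ⊕ ∂ b
  ∂-⊕ a b n = distribˡ _ _ _

  ∂-⊖ : ∀ a → ∂ (⊖ a) ≋ ⊖ ∂ a
  ∂-⊖ a n = sym (-‿distribʳ-* _ _)

  ∂-sc : ∀ x a → ∂ (sc x a) ≋ sc x (∂ a)
  ∂-sc x a n = solve 3 (λ i x a → i :* (x :* a) := x :* (i :* a)) refl _ _ _

  ∂-const : ∀ x → ∂ (const x) ≋ zeroS
  ∂-const x n = zeroʳ _

  ∂-⊛ : ∀ a b → ∂ (a ⊛ b) ≋ (∂ a ⊛ b) ⊕ (a ⊛ ∂ b)
  ∂-⊛ a b n = begin
    ι (suc n) * sumTo (suc (suc n)) (λ i → a i * b (suc n ∸ i))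
      ≈⟨ sumTo-*ˡ (suc (suc n)) _ _ ⟩
    sumTo (suc (suc n)) (λ i → ι (suc n) * (a i * b (suc n ∸ i)))
      ≈⟨ sumTo-cong-< (suc (suc n)) (λ i i<2+n → trans (*-congʳ (split (ℕ.≤-pred i<2+n))) (distribʳ _ _ _)) ⟩
    sumTo (suc (suc n)) (λ i → ι i * (a i * b (suc n ∸ i)) + ι (suc n ∸ i) * (a i * b (suc n ∸ i)))
      ≈⟨ sumTo-+ (suc (suc n)) _ _ ⟩
    sumTo (suc (suc n)) (λ i → ι i * (a i * b (suc n ∸ i))) + sumTo (suc (suc n)) (λ i → ι (suc n ∸ i) * (a i * b (suc n ∸ i)))
      ≈⟨ +-cong ∂a⊛b ∂b⊛a ⟩
    (∂ a ⊛ b) n + (a ⊛ ∂ b) n ∎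
    where
      split : ∀ {i} → i ≤ℕ suc n → ι (suc n) ≈ ι i + ι (suc n ∸ i)
      split {i} i≤1+n = trans (reflexive (≡.cong ι (≡.sym (ℕ.m+[n∸m]≡n i≤1+n)))) (ι-+ i (suc n ∸ i))
      ∂a⊛b : sumTo (suc (suc n)) (λ i → ι i * (a i * b (suc n ∸ i))) ≈ (∂ a ⊛ b) n
      ∂a⊛b = begin
        sumTo (suc (suc n)) (λ i → ι i * (a i * b (suc n ∸ i)))
          ≈⟨ sumTo-first (suc n) _ ⟩
        0# * (a 0 * b (suc n)) + sumTo (suc n) (λ i → ι (suc i) * (a (suc i) * b (n ∸ i)))
          ≈⟨ +-cong (zeroˡ _) (sumTo-cong (suc n) (λ i → sym (*-assoc _ _ _))) ⟩
        0# + (∂ a ⊛ b) n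
          ≈⟨ +-identityˡ _ ⟩
        (∂ a ⊛ b) n ∎
      ∂b⊛a : sumTo (suc (suc n)) (λ i → ι (suc n ∸ i) * (a i * b (suc n ∸ i))) ≈ (a ⊛ ∂ b) n
      ∂b⊛a = begin
        sumTo (suc n) (λ i → ι (suc n ∸ i) * (a i * b (suc n ∸ i))) + ι (n ∸ n) * (a (suc n) * b (n ∸ n))
          ≈⟨ +-cong (sumTo-cong-< (suc n) (λ i i<1+n →
                       trans (reflexive (≡.cong (λ m → ι m * (a i * b m)) (ℕ.+-∸-assoc 1 (ℕ.≤-pred i<1+n))))
                             (solve 3 (λ x y z → x :* (y :* z) := y :* (x :* z)) refl _ _ _)))
                    (trans (*-congʳ (reflexive (≡.cong ι (ℕ.n∸n≡0 n)))) (zeroˡ _)) ⟩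
        (a ⊛ ∂ b) n + 0#
          ≈⟨ +-identityʳ _ ⟩
        (a ⊛ ∂ b) n ∎

  ∂-pow : ∀ a m → ∂ (pow a (suc m)) ≋ sc (ι (suc m)) (pow a m ⊛ ∂ a)
  ∂-pow a zero n = begin
    ∂ (a ⊛ one) n                         ≈⟨ ∂-⊛ a one n ⟩
    (∂ a ⊛ one) n + (a ⊛ ∂ one) n         ≈⟨ +-cong (⊛-identityʳ (∂ a) n) (trans (⊛-congˡ a (∂-const 1#) n) (⊛-zeroʳ a n)) ⟩
    ∂ a n + 0#                            ≈⟨ +-identityʳ _ ⟩
    ∂ a n                                 ≈⟨ sym (trans (*-congʳ ι-1) (trans (*-identityˡ _) (⊛-identityˡ (∂ a) n))) ⟩
    ι 1 * (one ⊛ ∂ a) n                   ∎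
  ∂-pow a (suc m) n = begin
    ∂ (a ⊛ pow a (suc m)) n
      ≈⟨ ∂-⊛ a (pow a (suc m)) n ⟩
    (∂ a ⊛ pow a (suc m)) n + (a ⊛ ∂ (pow a (suc m))) n
      ≈⟨ +-cong (⊛-comm (∂ a) _ n) (⊛-congˡ a (∂-pow a m) n) ⟩
    (pow a (suc m) ⊛ ∂ a) n + (a ⊛ sc (ι (suc m)) (pow a m ⊛ ∂ a)) n
      ≈⟨ +-congˡ (trans (⊛-sc (ι (suc m)) a (pow a m ⊛ ∂ a) n) (*-congˡ (≋-sym (⊛-assoc a (pow a m) (∂ a)) n))) ⟩
    (pow a (suc m) ⊛ ∂ a) n + ι (suc m) * (pow a (suc m) ⊛ ∂ a) n
      ≈⟨ trans (+-congʳ (sym (*-identityˡ _))) (sym (distribʳ _ _ _)) ⟩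
    (1# + ι (suc m)) * (pow a (suc m) ⊛ ∂ a) n ∎

  ≋-by-∂ : ∀ (g h : Series) (Φ : ℕ → Carrier → Carrier) →
           (∀ l {u v} → u ≈ v → Φ l u ≈ Φ l v) →
           (∀ l → ∂ g l ≈ Φ l (g l)) → (∀ l → ∂ h l ≈ Φ l (h l)) → g 0 ≈ h 0 → g ≋ h
  ≋-by-∂ g h Φ Φ-cong ∂g ∂h g₀≈h₀ zero    = g₀≈h₀
  ≋-by-∂ g h Φ Φ-cong ∂g ∂h g₀≈h₀ (suc l) =
    *-cancelˡ (charZero l) (trans (∂g l) (trans (Φ-cong l (≋-by-∂ g h Φ Φ-cong ∂g ∂h g₀≈h₀ l)) (sym (∂h l))))

module ExpAndInverse {c ℓ} (F : CharZeroField c ℓ) where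
  open CharZeroField F
  open FPS F
  open FieldLemmas F
  open SumLemmas F
  open SeriesRing F
  open Derivative F

  ∂-exp : ∀ a → ∂ (expS a) ≋ sc a (expS a)
  ∂-exp a n = begin
    ι (suc n) * ((a * a ^ᶠ n) * ι (suc n !) ⁻¹)
      ≈⟨ solve 4 (λ i x y z → i :* ((x :* y) :* z) := x :* (y :* (i :* z))) refl _ _ _ _ ⟩
    a * (a ^ᶠ n * (ι (suc n) * ι (suc n !) ⁻¹))
      ≈⟨ *-congˡ (*-congˡ (ι[1+n]*ι[[1+n]!]⁻¹≈ι[n!]⁻¹ n)) ⟩
    a * (a ^ᶠ n * ι (n !) ⁻¹) ∎

  exp-0 : ∀ a → expS a 0 ≈ 1#
  exp-0 a = trans (*-identityˡ _) ι[1]⁻¹≈1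

  exp-cong : ∀ {a b} → a ≈ b → expS a ≋ expS b
  exp-cong {a} {b} a≈b n = *-congʳ (^-cong n)
    where
      ^-cong : ∀ n → a ^ᶠ n ≈ b ^ᶠ n
      ^-cong zero    = refl
      ^-cong (suc n) = *-cong a≈b (^-cong n)

  exp-+ : ∀ a b → expS a ⊛ expS b ≋ expS (a + b)
  exp-+ a b = ≋-by-∂ (expS a ⊛ expS b) (expS (a + b)) (λ _ u → (a + b) * u) (λ _ → *-congˡ)
    (λ l → begin
      ∂ (expS a ⊛ expS b) l
        ≈⟨ ∂-⊛ (expS a) (expS b) l ⟩
      (∂ (expS a) ⊛ expS b) l + (expS a ⊛ ∂ (expS b)) l
        ≈⟨ +-cong (⊛-congʳ (expS b) (∂-exp a) l) (⊛-congˡ (expS a) (∂-exp b) l) ⟩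
      (sc a (expS a) ⊛ expS b) l + (expS a ⊛ sc b (expS b)) l
        ≈⟨ +-cong (sc-⊛ a (expS a) (expS b) l) (⊛-sc b (expS a) (expS b) l) ⟩
      a * (expS a ⊛ expS b) l + b * (expS a ⊛ expS b) l
        ≈⟨ sym (distribʳ _ _ _) ⟩
      (a + b) * (expS a ⊛ expS b) l ∎)
    (∂-exp (a + b))
    (trans (⊛-0 (expS a) (expS b)) (trans (*-cong (exp-0 a) (exp-0 b)) (trans (*-identityˡ _) (sym (exp-0 (a + b))))))

  at-invVec : ∀ a n j → j ≤ℕ n → at j (invVec a n) ≡ inv a (n ∸ j)
  at-invVec a zero    zero    _         = ≡.refl
  at-invVec a (suc n) zero    _         = ≡.refl
  at-invVec a (suc n) (suc j) (s≤s j≤n) = at-invVec a n j j≤n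

  ⊛-inv : ∀ a → a 0 * (a 0 ⁻¹) ≈ 1# → a ⊛ inv a ≋ one
  ⊛-inv a a₀-invertible zero    = trans (+-identityˡ _) a₀-invertible
  ⊛-inv a a₀-invertible (suc n) = begin
    sumTo (suc (suc n)) (λ i → a i * inv a (suc n ∸ i))
      ≈⟨ sumTo-first (suc n) _ ⟩
    a 0 * inv a (suc n) + S
      ≈⟨ +-congʳ (*-congˡ (-‿cong (*-congˡ (sumTo-cong-< (suc n) (λ j j<1+n →
           *-congˡ (reflexive (at-invVec a n j (ℕ.≤-pred j<1+n)))))))) ⟩
    a 0 * - (a 0 ⁻¹ * S) + S
      ≈⟨ +-congʳ (trans (sym (-‿distribʳ-* _ _)) (-‿cong (trans (sym (*-assoc _ _ _)) (trans (*-congʳ a₀-invertible) (*-identityˡ _))))) ⟩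
    - S + S
      ≈⟨ -‿inverseˡ S ⟩
    0# ∎
    where
      S : Carrier
      S = sumTo (suc n) (λ i → a (suc i) * inv a (n ∸ i))

  ∂-inverse : ∀ u v → u ⊛ v ≋ one → ∂ v ≋ ⊖ ((v ⊛ v) ⊛ ∂ u)
  ∂-inverse u v u⊛v≋1 n = -‿unique _ _ (begin
    ((v ⊛ v) ⊛ ∂ u) n + ∂ v n
      ≈⟨ +-cong (≋-trans (⊛-assoc v v (∂ u)) (⊛-congˡ v (⊛-comm v (∂ u))) n)
                (sym (≋-trans (≋-sym (⊛-assoc v u (∂ v))) (≋-trans (⊛-congʳ (∂ v) (≋-trans (⊛-comm v u) u⊛v≋1)) (⊛-identityˡ (∂ v))) n)) ⟩
    (v ⊛ (∂ u ⊛ v)) n + (v ⊛ (u ⊛ ∂ v)) n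
      ≈⟨ sym (⊛-distribˡ (∂ u ⊛ v) (u ⊛ ∂ v) v n) ⟩
    (v ⊛ ((∂ u ⊛ v) ⊕ (u ⊛ ∂ v))) n
      ≈⟨ ⊛-congˡ v (≋-sym (∂-⊛ u v)) n ⟩
    (v ⊛ ∂ (u ⊛ v)) n
      ≈⟨ ⊛-congˡ v (≋-trans (∂-cong u⊛v≋1) (∂-const 1#)) n ⟩
    (v ⊛ zeroS) n
      ≈⟨ ⊛-zeroʳ v n ⟩
    0# ∎)

module FrobeniusKernel {c ℓ} (F : CharZeroField c ℓ) (lam : CharZeroField.Carrier F)
                       (lam≉1 : ¬ (CharZeroField._≈_ F lam (CharZeroField.1# F))) where
  open CharZeroField F
  open FPS F
  open FieldLemmas F
  open SeriesRing F
  open Derivative F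
  open ExpAndInverse F

  ω : Carrier
  ω = 1# - lam

  μ : Carrier
  μ = lam * ω ⁻¹

  ω≉0 : ¬ (ω ≈ 0#)
  ω≉0 ω≈0 = lam≉1 (begin
    lam        ≈⟨ sym (-‿involutive lam) ⟩
    - (- lam)  ≈⟨ -‿cong (-‿unique 1# (- lam) ω≈0) ⟩
    - (- 1#)   ≈⟨ -‿involutive 1# ⟩
    1#         ∎)

  μ*ω≈lam : μ * ω ≈ lam
  μ*ω≈lam = trans (*-assoc _ _ _) (trans (*-congˡ (inverseˡ ω ω≉0)) (*-identityʳ _))

  U : Series
  U = expS 1# ⊕ (⊖ const lam)

  V : Series
  V = inv U

  K : Series
  K = frobKernel lam

  U₀≈ω : U 0 ≈ ω
  U₀≈ω = +-congʳ (exp-0 1#)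

  U₀≉0 : ¬ (U 0 ≈ 0#)
  U₀≉0 U₀≈0 = ω≉0 (trans (sym U₀≈ω) U₀≈0)

  U⊛V≋1 : U ⊛ V ≋ one
  U⊛V≋1 = ⊛-inv U (inverseʳ (U 0) U₀≉0)

  ∂U : ∂ U ≋ U ⊕ const lam
  ∂U n = begin
    ∂ U n                                   ≈⟨ ∂-⊕ (expS 1#) (⊖ const lam) n ⟩
    ∂ (expS 1#) n + ∂ (⊖ const lam) n       ≈⟨ +-cong (trans (∂-exp 1# n) (*-identityˡ _))
                                                      (trans (∂-⊖ (const lam) n) (trans (-‿cong (∂-const lam n)) -0#≈0#)) ⟩
    expS 1# n + 0#                          ≈⟨ +-identityʳ _ ⟩
    expS 1# n                               ≈⟨ sym (trans (+-assoc _ _ _) (trans (+-congˡ (-‿inverseˡ _)) (+-identityʳ _))) ⟩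
    (U ⊕ const lam) n                       ∎

  ∂V : ∂ V ≋ ⊖ (V ⊕ sc lam (V ⊛ V))
  ∂V = ≋-trans (∂-inverse U V U⊛V≋1) (⊖-cong (≋-trans (⊛-congˡ (V ⊛ V) ∂U)
         (≋-trans (⊛-distribˡ U (const lam) (V ⊛ V))
           (⊕-cong (≋-trans (⊛-assoc V V U) (≋-trans (⊛-congˡ V (≋-trans (⊛-comm V U) U⊛V≋1)) (⊛-identityʳ V)))
                   (≋-trans (⊛-comm (V ⊛ V) (const lam)) (const-⊛ lam (V ⊛ V)))))))

  K≋ωV : K ≋ sc ω V
  K≋ωV = const-⊛ ω V

  ∂K : ∂ K ≋ ⊖ (K ⊕ sc μ (K ⊛ K))
  ∂K n = begin
    ∂ K n                                ≈⟨ ∂-cong K≋ωV n ⟩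
    ∂ (sc ω V) n                         ≈⟨ ∂-sc ω V n ⟩
    ω * ∂ V n                            ≈⟨ *-congˡ (∂V n) ⟩
    ω * - (V n + lam * (V ⊛ V) n)        ≈⟨ sym (-‿distribʳ-* _ _) ⟩
    - (ω * (V n + lam * (V ⊛ V) n))      ≈⟨ -‿cong (trans (distribˡ _ _ _) (+-cong (sym (K≋ωV n)) (sym quadratic))) ⟩
    - (K n + μ * (K ⊛ K) n)              ∎
    where
      quadratic : μ * (K ⊛ K) n ≈ ω * (lam * (V ⊛ V) n)
      quadratic = begin
        μ * (K ⊛ K) n                 ≈⟨ *-congˡ (trans (⊛-cong K≋ωV K≋ωV n) (trans (sc-⊛ ω V (sc ω V) n) (*-congˡ (⊛-sc ω V V n)))) ⟩
        μ * (ω * (ω * (V ⊛ V) n))     ≈⟨ solve 4 (λ m w w′ v → m :* (w :* (w′ :* v)) := w′ :* ((m :* w) :* v)) refl μ ω ω _ ⟩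
        ω * ((μ * ω) * (V ⊛ V) n)     ≈⟨ *-congˡ (*-congʳ μ*ω≈lam) ⟩
        ω * (lam * (V ⊛ V) n)         ∎

  K₀≈1 : K 0 ≈ 1#
  K₀≈1 = begin
    K 0           ≈⟨ K≋ωV 0 ⟩
    ω * inv U 0   ≈⟨ *-congˡ (⁻¹-cong U₀≉0 U₀≈ω) ⟩
    ω * ω ⁻¹      ≈⟨ inverseʳ ω ω≉0 ⟩
    1#            ∎

  J : Series
  J = inv K

  K⊛J≋1 : K ⊛ J ≋ one
  K⊛J≋1 = ⊛-inv K (inverseʳ (K 0) (λ K₀≈0 → 1≉0 (trans (sym K₀≈1) K₀≈0)))

  J⊛K≋1 : J ⊛ K ≋ one
  J⊛K≋1 = ≋-trans (⊛-comm J K) K⊛J≋1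

  ∂J : ∂ J ≋ J ⊕ sc μ one
  ∂J n = begin
    ∂ J n
      ≈⟨ ∂-inverse K J K⊛J≋1 n ⟩
    - ((J ⊛ J) ⊛ ∂ K) n
      ≈⟨ -‿cong (trans (⊛-congˡ (J ⊛ J) ∂K n) (⊛-⊖ (J ⊛ J) (K ⊕ sc μ (K ⊛ K)) n)) ⟩
    - - ((J ⊛ J) ⊛ (K ⊕ sc μ (K ⊛ K))) n
      ≈⟨ -‿involutive _ ⟩
    ((J ⊛ J) ⊛ (K ⊕ sc μ (K ⊛ K))) n
      ≈⟨ ⊛-distribˡ K (sc μ (K ⊛ K)) (J ⊛ J) n ⟩
    ((J ⊛ J) ⊛ K) n + ((J ⊛ J) ⊛ sc μ (K ⊛ K)) n
      ≈⟨ +-cong (J²K≋J n) (trans (⊛-sc μ (J ⊛ J) (K ⊛ K) n) (*-congˡ (J²K²≋1 n))) ⟩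
    J n + μ * one n ∎
    where
      J²K≋J : (J ⊛ J) ⊛ K ≋ J
      J²K≋J = ≋-trans (⊛-assoc J J K) (≋-trans (⊛-congˡ J J⊛K≋1) (⊛-identityʳ J))
      J²K²≋1 : (J ⊛ J) ⊛ (K ⊛ K) ≋ one
      J²K²≋1 = ≋-trans (≋-sym (⊛-assoc (J ⊛ J) K K)) (≋-trans (⊛-congʳ K J²K≋J) J⊛K≋1)

  β : ℤ → Carrier
  β r = (ιℤ r * lam) * ω ⁻¹

  *-distrib-+μ* : ∀ s X Y → s * (X + μ * Y) ≈ s * X + ((s * lam) * ω ⁻¹) * Y
  *-distrib-+μ* s X Y =
    solve 5 (λ s X Y l w → s :* (X :+ (l :* w) :* Y) := s :* X :+ ((s :* l) :* w) :* Y) refl s X Y lam (ω ⁻¹)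

  ∂-powℤ-K : ∀ r → ∂ (powℤ K r) ≋ ⊖ (sc (ιℤ r) (powℤ K r) ⊕ sc (β r) (powℤ K (r +ℤ + 1)))
  ∂-powℤ-K (+ zero) n = begin
    ∂ one n                                 ≈⟨ ∂-const 1# n ⟩
    0#                                      ≈⟨ sym -0#≈0# ⟩
    - 0#                                    ≈⟨ -‿cong (sym (trans (+-cong (zeroˡ _) (zeroˡ _)) (+-identityˡ _))) ⟩
    - (0# * one n + 0# * pow K 1 n)         ≈⟨ -‿cong (+-congˡ (*-congʳ (sym β0≈0))) ⟩
    - (0# * one n + β (+ 0) * pow K 1 n)    ∎
    where
      β0≈0 : β (+ 0) ≈ 0#
      β0≈0 = trans (*-congʳ (zeroˡ _)) (zeroˡ _)
  ∂-powℤ-K (+ suc m) n = begin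
    ∂ (pow K (suc m)) n
      ≈⟨ ∂-pow K m n ⟩
    ι (suc m) * (pow K m ⊛ ∂ K) n
      ≈⟨ *-congˡ (trans (⊛-congˡ (pow K m) ∂K n) (⊛-⊖ (pow K m) (K ⊕ sc μ (K ⊛ K)) n)) ⟩
    ι (suc m) * - (pow K m ⊛ (K ⊕ sc μ (K ⊛ K))) n
      ≈⟨ *-congˡ (-‿cong (trans (⊛-distribˡ K (sc μ (K ⊛ K)) (pow K m) n) (+-congˡ (⊛-sc μ (pow K m) (K ⊛ K) n)))) ⟩
    ι (suc m) * - ((pow K m ⊛ K) n + μ * (pow K m ⊛ (K ⊛ K)) n)
      ≈⟨ *-congˡ (-‿cong (+-cong (⊛-comm (pow K m) K n) (*-congˡ Kᵐ⊛K²≋Kᵐ⁺² ))) ⟩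
    ι (suc m) * - (pow K (suc m) n + μ * pow K (suc (suc m)) n)
      ≈⟨ sym (-‿distribʳ-* _ _) ⟩
    - (ι (suc m) * (pow K (suc m) n + μ * pow K (suc (suc m)) n))
      ≈⟨ -‿cong (*-distrib-+μ* (ι (suc m)) _ _) ⟩
    - (ι (suc m) * pow K (suc m) n + β (+ suc m) * pow K (suc (suc m)) n)
      ≈⟨ -‿cong (+-congˡ (*-congˡ (reflexive (≡.cong (λ k → pow K k n) (ℕ.+-comm 1 (suc m)))))) ⟩
    - (ι (suc m) * pow K (suc m) n + β (+ suc m) * pow K (suc m +ℕ 1) n) ∎
    where
      Kᵐ⊛K²≋Kᵐ⁺² : (pow K m ⊛ (K ⊛ K)) n ≈ pow K (suc (suc m)) n
      Kᵐ⊛K²≋Kᵐ⁺² = trans (⊛-comm (pow K m) (K ⊛ K) n) (⊛-assoc K K (pow K m) n)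
  ∂-powℤ-K -[1+ m ] n = begin
    ∂ (pow J (suc m)) n
      ≈⟨ ∂-pow J m n ⟩
    ι (suc m) * (pow J m ⊛ ∂ J) n
      ≈⟨ *-congˡ (trans (⊛-congˡ (pow J m) ∂J n) (⊛-distribˡ J (sc μ one) (pow J m) n)) ⟩
    ι (suc m) * ((pow J m ⊛ J) n + (pow J m ⊛ sc μ one) n)
      ≈⟨ *-congˡ (+-cong (⊛-comm (pow J m) J n) (trans (⊛-sc μ (pow J m) one n) (*-congˡ (⊛-identityʳ (pow J m) n)))) ⟩
    ι (suc m) * (pow J (suc m) n + μ * pow J m n)
      ≈⟨ sym (-‿involutive _) ⟩
    - (- (ι (suc m) * (pow J (suc m) n + μ * pow J m n)))
      ≈⟨ -‿cong (-‿distribˡ-* _ _) ⟩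
    - ((- ι (suc m)) * (pow J (suc m) n + μ * pow J m n))
      ≈⟨ -‿cong (*-distrib-+μ* (- ι (suc m)) _ _) ⟩
    - ((- ι (suc m)) * pow J (suc m) n + β -[1+ m ] * pow J m n)
      ≈⟨ -‿cong (+-congˡ (*-congˡ (sym (powℤ-K-[-[1+m]+1] m n)))) ⟩
    - ((- ι (suc m)) * pow J (suc m) n + β -[1+ m ] * powℤ K (-[1+ m ] +ℤ + 1) n) ∎
    where
      powℤ-K-[-[1+m]+1] : ∀ m → powℤ K (-[1+ m ] +ℤ + 1) ≋ pow J m
      powℤ-K-[-[1+m]+1] zero    = ≋-refl {one}
      powℤ-K-[-[1+m]+1] (suc m) = ≋-refl {pow J (suc m)}

module OneMinusExpNeg {c ℓ} (F : CharZeroField c ℓ) where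
  open CharZeroField F
  open FPS F
  open FieldLemmas F
  open SumLemmas F
  open SeriesRing F
  open Derivative F
  open ExpAndInverse F

  y : Series
  y = oneMinusExpNeg

  E : Series
  E = expS (- 1#)

  ∂y : ∂ y ≋ E
  ∂y n = begin
    ∂ y n                   ≈⟨ ∂-⊕ one (⊖ E) n ⟩
    ∂ one n + ∂ (⊖ E) n     ≈⟨ +-cong (∂-const 1# n) (∂-⊖ E n) ⟩
    0# + - ∂ E n            ≈⟨ +-identityˡ _ ⟩
    - ∂ E n                 ≈⟨ -‿cong (trans (∂-exp (- 1#) n) (-1*x≈-x _)) ⟩
    - (- E n)               ≈⟨ -‿involutive _ ⟩
    E n                     ∎

  E≋1-y : E ≋ one ⊕ (⊖ y)
  E≋1-y n = sym (begin
    one n + - (one n + - E n)        ≈⟨ +-congˡ (-‿distrib-+ _ _) ⟩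
    one n + (- one n + - - E n)      ≈⟨ sym (+-assoc _ _ _) ⟩
    (one n + - one n) + - - E n      ≈⟨ +-cong (-‿inverseʳ _) (-‿involutive _) ⟩
    0# + E n                         ≈⟨ +-identityˡ _ ⟩
    E n                              ∎)

  y₀≈0 : y 0 ≈ 0#
  y₀≈0 = trans (+-congˡ (-‿cong (exp-0 (- 1#)))) (-‿inverseʳ 1#)

  stirlingSeries : ℕ → Series
  stirlingSeries m l = (sign (l +ℕ m) * ι (m !)) * (ι (S₂ l m) * ι (l !) ⁻¹)

  stirlingSeries-< : ∀ m l → l <ℕ m → stirlingSeries m l ≈ 0#
  stirlingSeries-< m l l<m =
    trans (*-congˡ (trans (*-congʳ (reflexive (≡.cong ι (S₂-< l m l<m)))) (zeroˡ _))) (zeroʳ _)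

  ∂-stirlingSeries : ∀ m l → ∂ (stirlingSeries (suc m)) l ≈ ι (suc m) * (stirlingSeries m l + - stirlingSeries (suc m) l)
  ∂-stirlingSeries m l = begin
    ι (suc l) * ((sign (suc l +ℕ suc m) * ι (suc m !)) * (ι (S₂ (suc l) (suc m)) * ι (suc l !) ⁻¹))
      ≈⟨ *-congˡ (*-cong (*-cong (trans (reflexive (≡.cong (λ k → sign (suc k)) (ℕ.+-suc l m))) (sign-2+ (l +ℕ m))) (ι-* (suc m) (m !)))
                         (*-congʳ (trans (ι-+ (suc m *ℕ S₂ l (suc m)) (S₂ l m)) (+-congʳ (ι-* (suc m) (S₂ l (suc m))))))) ⟩
    ι (suc l) * ((σ * (ι (suc m) * ι (m !))) * ((ι (suc m) * A + B) * ι (suc l !) ⁻¹))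
      ≈⟨ solve 7 (λ il σ im imf A B ilf → il :* ((σ :* (im :* imf)) :* ((im :* A :+ B) :* ilf))
                 := im :* ((σ :* imf) :* (B :* (il :* ilf)) :+ (σ :* (im :* imf)) :* (A :* (il :* ilf)))) refl _ _ _ _ _ _ _ ⟩
    ι (suc m) * ((σ * ι (m !)) * (B * (ι (suc l) * ι (suc l !) ⁻¹)) + (σ * (ι (suc m) * ι (m !))) * (A * (ι (suc l) * ι (suc l !) ⁻¹)))
      ≈⟨ *-congˡ (+-cong (*-congˡ (*-congˡ (ι[1+n]*ι[[1+n]!]⁻¹≈ι[n!]⁻¹ l))) (*-congˡ (*-congˡ (ι[1+n]*ι[[1+n]!]⁻¹≈ι[n!]⁻¹ l)))) ⟩
    ι (suc m) * (stirlingSeries m l + (σ * (ι (suc m) * ι (m !))) * (A * ι (l !) ⁻¹))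
      ≈⟨ *-congˡ (+-congˡ (sym -stirlingSeries)) ⟩
    ι (suc m) * (stirlingSeries m l + - stirlingSeries (suc m) l) ∎
    where
      σ = sign (l +ℕ m)
      A = ι (S₂ l (suc m))
      B = ι (S₂ l m)
      -stirlingSeries : - stirlingSeries (suc m) l ≈ (σ * (ι (suc m) * ι (m !))) * (A * ι (l !) ⁻¹)
      -stirlingSeries = begin
        - ((sign (l +ℕ suc m) * ι (suc m !)) * (A * ι (l !) ⁻¹))
          ≈⟨ -‿cong (*-congʳ (*-cong (trans (reflexive (≡.cong sign (ℕ.+-suc l m))) (sign-suc (l +ℕ m))) (ι-* (suc m) (m !)))) ⟩
        - (((- σ) * (ι (suc m) * ι (m !))) * (A * ι (l !) ⁻¹))
          ≈⟨ -‿cong (trans (*-congʳ (sym (-‿distribˡ-* _ _))) (sym (-‿distribˡ-* _ _))) ⟩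
        - - ((σ * (ι (suc m) * ι (m !))) * (A * ι (l !) ⁻¹))
          ≈⟨ -‿involutive _ ⟩
        (σ * (ι (suc m) * ι (m !))) * (A * ι (l !) ⁻¹) ∎

  pow-y : ∀ m → pow y m ≋ stirlingSeries m
  pow-y zero zero    = sym (trans (*-cong (trans (*-identityˡ _) ι-1) (inverseʳ _ (charZero 0))) (*-identityˡ _))
  pow-y zero (suc l) = sym (trans (*-congˡ (zeroˡ _)) (zeroʳ _))
  pow-y (suc m) =
    ≋-by-∂ (pow y (suc m)) (stirlingSeries (suc m)) (λ l u → ι (suc m) * (stirlingSeries m l + - u))
           (λ l u≈v → *-congˡ (+-congˡ (-‿cong u≈v)))
    (λ l → begin
       ∂ (pow y (suc m)) l
         ≈⟨ ∂-pow y m l ⟩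
       ι (suc m) * (pow y m ⊛ ∂ y) l
         ≈⟨ *-congˡ (trans (⊛-congˡ (pow y m) (≋-trans ∂y E≋1-y) l) (⊛-distribˡ one (⊖ y) (pow y m) l)) ⟩
       ι (suc m) * ((pow y m ⊛ one) l + (pow y m ⊛ (⊖ y)) l)
         ≈⟨ *-congˡ (+-cong (⊛-identityʳ (pow y m) l) (trans (⊛-⊖ (pow y m) y l) (-‿cong (⊛-comm (pow y m) y l)))) ⟩
       ι (suc m) * (pow y m l + - pow y (suc m) l)
         ≈⟨ *-congˡ (+-congʳ (pow-y m l)) ⟩
       ι (suc m) * (stirlingSeries m l + - pow y (suc m) l) ∎)
    (∂-stirlingSeries m)
    (trans (⊛-0 y (pow y m)) (trans (*-congʳ y₀≈0) (trans (zeroˡ _) (sym (stirlingSeries-< (suc m) 0 (s≤s z≤n))))))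

  pow-y-< : ∀ m l → l <ℕ m → pow y m l ≈ 0#
  pow-y-< m l l<m = trans (pow-y m l) (stirlingSeries-< m l l<m)

  ∂-compose : ∀ f → ∂ (compose f y) ≋ compose (∂ f) y ⊛ E
  ∂-compose f n = begin
    ι (suc n) * sumTo (suc (suc n)) (λ m → f m * pow y m (suc n))
      ≈⟨ trans (sumTo-*ˡ (suc (suc n)) _ _) (sumTo-first (suc n) _) ⟩
    ι (suc n) * (f 0 * pow y 0 (suc n)) + sumTo (suc n) (λ m → ι (suc n) * (f (suc m) * pow y (suc m) (suc n)))
      ≈⟨ +-cong (trans (*-congˡ (zeroʳ _)) (zeroʳ _)) (sumTo-cong (suc n) chain) ⟩
    0# + sumTo (suc n) (λ m → ∂ f m * (pow y m ⊛ E) n)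
      ≈⟨ +-identityˡ _ ⟩
    sumTo (suc n) (λ m → ∂ f m * (pow y m ⊛ E) n)
      ≈⟨ sumTo-cong (suc n) (λ m → trans (sumTo-*ˡ (suc n) (∂ f m) _) (sumTo-cong (suc n) (λ i → sym (*-assoc _ _ _)))) ⟩
    sumTo (suc n) (λ m → sumTo (suc n) (λ i → (∂ f m * pow y m i) * E (n ∸ i)))
      ≈⟨ sumTo-swap (suc n) (suc n) _ ⟩
    sumTo (suc n) (λ i → sumTo (suc n) (λ m → (∂ f m * pow y m i) * E (n ∸ i)))
      ≈⟨ sumTo-cong-< (suc n) (λ i i<1+n → trans (sym (sumTo-*ʳ (suc n) (E (n ∸ i)) _)) (*-congʳ (truncate i (ℕ.≤-pred i<1+n)))) ⟩
    (compose (∂ f) y ⊛ E) n ∎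
    where
      chain : ∀ m → ι (suc n) * (f (suc m) * pow y (suc m) (suc n)) ≈ ∂ f m * (pow y m ⊛ E) n
      chain m = begin
        ι (suc n) * (f (suc m) * pow y (suc m) (suc n))     ≈⟨ solve 3 (λ a b d → a :* (b :* d) := b :* (a :* d)) refl _ _ _ ⟩
        f (suc m) * ∂ (pow y (suc m)) n                     ≈⟨ *-congˡ (∂-pow y m n) ⟩
        f (suc m) * (ι (suc m) * (pow y m ⊛ ∂ y) n)         ≈⟨ solve 3 (λ a b d → a :* (b :* d) := (b :* a) :* d) refl _ _ _ ⟩
        ∂ f m * (pow y m ⊛ ∂ y) n                           ≈⟨ *-congˡ (⊛-congˡ (pow y m) ∂y n) ⟩
        ∂ f m * (pow y m ⊛ E) n                             ∎
      truncate : ∀ i → i ≤ℕ n → sumTo (suc n) (λ m → ∂ f m * pow y m i) ≈ compose (∂ f) y i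
      truncate i i≤n =
        trans (reflexive (≡.cong (λ k → sumTo k (λ m → ∂ f m * pow y m i)) (≡.sym (≡.cong suc (ℕ.m+[n∸m]≡n i≤n)))))
              (sumTo-vanishing-tail (suc i) (n ∸ i) (λ m i<m _ → trans (*-congˡ (pow-y-< m i i<m)) (zeroʳ _)))

module GeneratingFunction {c ℓ} (F : CharZeroField c ℓ) (lam : CharZeroField.Carrier F)
                          (lam≉1 : ¬ (CharZeroField._≈_ F lam (CharZeroField.1# F)))
                          (r k : ℤ) (x : CharZeroField.Carrier F) where
  open CharZeroField F
  open FPS F
  open FieldLemmas F
  open SumLemmas F
  open SeriesRing F
  open Derivative F
  open ExpAndInverse F
  open FrobeniusKernel F lam lam≉1
  open OneMinusExpNeg F

  Li∘y : Series
  Li∘y = compose (LiOverId k) y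

  G : ℤ → Series
  G s = (powℤ K s ⊛ Li∘y) ⊛ expS x

  Q : Series
  Q = powℤ K r ⊛ expS (x - 1#)

  W : Series
  W = compose (∂ (LiOverId k)) y

  stirlingSum : ℕ → Carrier
  stirlingSum j = sumTo (suc j) (λ m → (sign m * (ι (suc m !) * ((ι (suc (suc m)) ^ℤ k) ⁻¹))) * ι (S₂ j m))

  Kʳ⊛∂[Li∘y]⊛exp : (powℤ K r ⊛ ∂ Li∘y) ⊛ expS x ≋ Q ⊛ W
  Kʳ⊛∂[Li∘y]⊛exp n = begin
    ((powℤ K r ⊛ ∂ Li∘y) ⊛ expS x) n      ≈⟨ ⊛-congʳ (expS x) (⊛-congˡ (powℤ K r) (∂-compose (LiOverId k))) n ⟩
    ((powℤ K r ⊛ (W ⊛ E)) ⊛ expS x) n     ≈⟨ ⊛-assoc (powℤ K r) (W ⊛ E) (expS x) n ⟩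
    (powℤ K r ⊛ ((W ⊛ E) ⊛ expS x)) n     ≈⟨ ⊛-congˡ (powℤ K r) (≋-trans (⊛-assoc W E (expS x)) (⊛-congˡ W E⊛exp)) n ⟩
    (powℤ K r ⊛ (W ⊛ expS (x - 1#))) n    ≈⟨ ⊛-congˡ (powℤ K r) (⊛-comm W (expS (x - 1#))) n ⟩
    (powℤ K r ⊛ (expS (x - 1#) ⊛ W)) n    ≈⟨ ⊛-assoc (powℤ K r) (expS (x - 1#)) W n ⟨
    (Q ⊛ W) n                             ∎
    where
      E⊛exp : E ⊛ expS x ≋ expS (x - 1#)
      E⊛exp = ≋-trans (exp-+ (- 1#) x) (exp-cong (+-comm _ _))

  ∂Kʳ⊛[Li∘y]⊛exp : (∂ (powℤ K r) ⊛ Li∘y) ⊛ expS x ≋ ⊖ (sc (ιℤ r) (G r) ⊕ sc (β r) (G (r +ℤ + 1)))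
  ∂Kʳ⊛[Li∘y]⊛exp n = begin
    ((∂ (powℤ K r) ⊛ Li∘y) ⊛ expS x) n
      ≈⟨ ⊛-congʳ (expS x) (⊛-congʳ Li∘y (∂-powℤ-K r)) n ⟩
    (((⊖ (sc (ιℤ r) Kʳ ⊕ sc (β r) Kʳ⁺¹)) ⊛ Li∘y) ⊛ expS x) n
      ≈⟨ trans (⊛-congʳ (expS x) (⊖-⊛ (sc (ιℤ r) Kʳ ⊕ sc (β r) Kʳ⁺¹) Li∘y) n) (⊖-⊛ _ (expS x) n) ⟩
    - (((sc (ιℤ r) Kʳ ⊕ sc (β r) Kʳ⁺¹) ⊛ Li∘y) ⊛ expS x) n
      ≈⟨ -‿cong (trans (⊛-congʳ (expS x) (⊛-distribʳ (sc (ιℤ r) Kʳ) (sc (β r) Kʳ⁺¹) Li∘y) n)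
                       (⊛-distribʳ (sc (ιℤ r) Kʳ ⊛ Li∘y) (sc (β r) Kʳ⁺¹ ⊛ Li∘y) (expS x) n)) ⟩
    - (((sc (ιℤ r) Kʳ ⊛ Li∘y) ⊛ expS x) n + ((sc (β r) Kʳ⁺¹ ⊛ Li∘y) ⊛ expS x) n)
      ≈⟨ -‿cong (+-cong (scalar (ιℤ r) Kʳ) (scalar (β r) Kʳ⁺¹)) ⟩
    - (ιℤ r * G r n + β r * G (r +ℤ + 1) n) ∎
    where
      Kʳ Kʳ⁺¹ : Series
      Kʳ   = powℤ K r
      Kʳ⁺¹ = powℤ K (r +ℤ + 1)
      scalar : ∀ a P → ((sc a P ⊛ Li∘y) ⊛ expS x) n ≈ a * ((P ⊛ Li∘y) ⊛ expS x) n
      scalar a P = trans (⊛-congʳ (expS x) (sc-⊛ a P Li∘y) n) (sc-⊛ a (P ⊛ Li∘y) (expS x) n)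

  ∂G : ∀ n → ∂ (G r) n ≈ (- (ιℤ r * G r n + β r * G (r +ℤ + 1) n) + (Q ⊛ W) n) + x * G r n
  ∂G n = begin
    ∂ (G r) n
      ≈⟨ ∂-⊛ (powℤ K r ⊛ Li∘y) (expS x) n ⟩
    (∂ (powℤ K r ⊛ Li∘y) ⊛ expS x) n + ((powℤ K r ⊛ Li∘y) ⊛ ∂ (expS x)) n
      ≈⟨ +-cong (trans (⊛-congʳ (expS x) (∂-⊛ (powℤ K r) Li∘y) n) (⊛-distribʳ (∂ (powℤ K r) ⊛ Li∘y) (powℤ K r ⊛ ∂ Li∘y) (expS x) n))
                (trans (⊛-congˡ (powℤ K r ⊛ Li∘y) (∂-exp x) n) (⊛-sc x (powℤ K r ⊛ Li∘y) (expS x) n)) ⟩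
    (((∂ (powℤ K r) ⊛ Li∘y) ⊛ expS x) n + ((powℤ K r ⊛ ∂ Li∘y) ⊛ expS x) n) + x * G r n
      ≈⟨ +-congʳ (+-cong (∂Kʳ⊛[Li∘y]⊛exp n) (Kʳ⊛∂[Li∘y]⊛exp n)) ⟩
    (- (ιℤ r * G r n + β r * G (r +ℤ + 1) n) + (Q ⊛ W) n) + x * G r n ∎

  ι[j!]*W≈sign*stirlingSum : ∀ j → ι (j !) * W j ≈ sign j * stirlingSum j
  ι[j!]*W≈sign*stirlingSum j = begin
    ι (j !) * W j                                          ≈⟨ sumTo-*ˡ (suc j) _ _ ⟩
    sumTo (suc j) (λ m → ι (j !) * (∂ Li m * pow y m j))   ≈⟨ sumTo-cong (suc j) term ⟩
    sumTo (suc j) (λ m → sign j * stirlingTerm m)          ≈⟨ sumTo-*ˡ (suc j) _ _ ⟨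
    sign j * stirlingSum j                                 ∎
    where
      Li : Series
      Li = LiOverId k
      stirlingTerm : ℕ → Carrier
      stirlingTerm m = (sign m * (ι (suc m !) * Li (suc m))) * ι (S₂ j m)
      term : ∀ m → ι (j !) * (∂ Li m * pow y m j) ≈ sign j * stirlingTerm m
      term m = begin
        ι (j !) * (∂ Li m * pow y m j)
          ≈⟨ *-congˡ (*-congˡ (trans (pow-y m j) (*-congʳ (*-congʳ (sign-+ j m))))) ⟩
        ι (j !) * ((ι (suc m) * Li (suc m)) * (((sign j * sign m) * ι (m !)) * (ι (S₂ j m) * ι (j !) ⁻¹)))
          ≈⟨ solve 8 (λ f ism c sj sm imf S fi → f :* ((ism :* c) :* (((sj :* sm) :* imf) :* (S :* fi)))
                      := (sj :* ((sm :* ((ism :* imf) :* c)) :* S)) :* (f :* fi)) refl _ _ _ _ _ _ _ _ ⟩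
        (sign j * ((sign m * ((ι (suc m) * ι (m !)) * Li (suc m))) * ι (S₂ j m))) * (ι (j !) * ι (j !) ⁻¹)
          ≈⟨ *-cong (*-congˡ (*-congʳ (*-congˡ (*-congʳ (sym (ι-* (suc m) (m !))))))) (inverseʳ _ (ι[n!]≉0 j)) ⟩
        (sign j * stirlingTerm m) * 1#
          ≈⟨ *-identityʳ _ ⟩
        sign j * stirlingTerm m ∎

  ι[n!]*[Q⊛W]≈binomialSum : ∀ n → ι (n !) * (Q ⊛ W) n ≈
    sumTo (suc n) (λ l → (sign (n ∸ l) * (ι (n C l) * stirlingSum (n ∸ l))) * H lam r l (x - 1#))
  ι[n!]*[Q⊛W]≈binomialSum n = trans (sumTo-*ˡ (suc n) _ _) (sumTo-cong-< (suc n) (λ l l<1+n → term l (ℕ.≤-pred l<1+n)))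
    where
      term : ∀ l → l ≤ℕ n → ι (n !) * (Q l * W (n ∸ l)) ≈ (sign (n ∸ l) * (ι (n C l) * stirlingSum (n ∸ l))) * (ι (l !) * Q l)
      term l l≤n = begin
        ι (n !) * (Q l * W (n ∸ l))
          ≈⟨ *-congʳ (trans (reflexive (≡.cong ι (n!≡[nCl]*[l!*[n∸l]!] n l l≤n)))
                            (trans (ι-* (n C l) (l ! *ℕ (n ∸ l) !)) (*-congˡ (ι-* (l !) ((n ∸ l) !))))) ⟩
        (ι (n C l) * (ι (l !) * ι ((n ∸ l) !))) * (Q l * W (n ∸ l))
          ≈⟨ solve 5 (λ a b d q v → (a :* (b :* d)) :* (q :* v) := (a :* (d :* v)) :* (b :* q)) refl _ _ _ _ _ ⟩
        (ι (n C l) * (ι ((n ∸ l) !) * W (n ∸ l))) * (ι (l !) * Q l)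
          ≈⟨ *-congʳ (*-congˡ (ι[j!]*W≈sign*stirlingSum (n ∸ l))) ⟩
        (ι (n C l) * (sign (n ∸ l) * stirlingSum (n ∸ l))) * (ι (l !) * Q l)
          ≈⟨ *-congʳ (solve 3 (λ a b d → a :* (b :* d) := b :* (a :* d)) refl _ _ _) ⟩
        (sign (n ∸ l) * (ι (n C l) * stirlingSum (n ∸ l))) * (ι (l !) * Q l) ∎

theorem5 : ∀ {c ℓ} (F : CharZeroField c ℓ) →
  let open CharZeroField F
      open FPS F
  in (lam : Carrier) → ¬ (lam ≈ 1#) → (r k : ℤ) (n : ℕ) (x : Carrier) →
     T lam r k (suc n) x ≈
       ((((x - ιℤ r) * T lam r k n x)
         - (((ιℤ r * lam) * ((1# - lam) ⁻¹)) * T lam (r +ℤ + 1) k n x))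
        + sumTo (suc n) (λ l →
            (((- 1#) ^ᶠ (n ∸ l)) * (ι (n C l) *
              sumTo (suc (n ∸ l)) (λ m →
                (((- 1#) ^ᶠ m) * (ι (suc m !) * ((ι (suc (suc m)) ^ℤ k) ⁻¹)))
                  * ι (S₂ (n ∸ l) m))))
            * H lam r l (x - 1#)))
theorem5 F lam lam≉1 r k n x = begin
  ι (suc n !) * G r (suc n)
    ≈⟨ *-congʳ (ι-* (suc n) (n !)) ⟩
  (ι (suc n) * ι (n !)) * G r (suc n)
    ≈⟨ solve 3 (λ a b g → (a :* b) :* g := b :* (a :* g)) refl _ _ _ ⟩
  ι (n !) * ∂ (G r) n
    ≈⟨ *-congˡ (∂G n) ⟩
  ι (n !) * ((- (ρ * G r n + β r * G r′ n) + (Q ⊛ W) n) + x * G r n)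
    ≈⟨ *-congˡ (+-congʳ (+-congʳ (trans (-‿distrib-+ _ _) (+-cong (-‿distribˡ-* _ _) (-‿distribˡ-* _ _))))) ⟩
  ι (n !) * ((((- ρ) * G r n + (- β r) * G r′ n) + (Q ⊛ W) n) + x * G r n)
    ≈⟨ solve 7 (λ f -ρ g -β g′ q x → f :* (((-ρ :* g :+ -β :* g′) :+ q) :+ x :* g)
               := ((x :+ -ρ) :* (f :* g) :+ -β :* (f :* g′)) :+ f :* q) refl _ _ _ _ _ _ _ ⟩
  ((x - ρ) * T lam r k n x + (- β r) * T lam r′ k n x) + ι (n !) * (Q ⊛ W) n
    ≈⟨ +-cong (+-congˡ (sym (-‿distribˡ-* _ _))) (ι[n!]*[Q⊛W]≈binomialSum n) ⟩
  ((x - ρ) * T lam r k n x - β r * T lam r′ k n x)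
    + sumTo (suc n) (λ l → (sign (n ∸ l) * (ι (n C l) * stirlingSum (n ∸ l))) * H lam r l (x - 1#)) ∎
  where
    open CharZeroField F
    open FPS F
    open FieldLemmas F
    open Derivative F
    open FrobeniusKernel F lam lam≉1
    open GeneratingFunction F lam lam≉1 r k x
    ρ : Carrier
    ρ = ιℤ r
    r′ : ℤ
    r′ = r +ℤ + 1
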